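{- Let $r\geq 2$ be an integer and let $G$ be a $K_{r+1}$-free graph. If $A,B\subseteq V(G)$ are disjoint cliques with $|A|=r$ and $B=\{x,y\}$, then ${\rm ext}_G(A,B)\leq r^2-\binom{r-1}{2}$.
   Context: All graphs are finite and simple. An orientation is $K^\circlearrowright_3$-free if it contains no cyclically oriented triangle. For a graph $G$, $\mathcal{D}(G)$ denotes the set of $K^\circlearrowright_3$-free orientations of $G$. Orientations $\vec S,\vec T$ of disjoint edge sets are compatible if $\vec S\cup\vec T$ is $K^\circlearrowright_3$-free. For disjoint $A,B\subseteq V(G)$, $G[A,B]$ denotes the graph with the edges of $G$ between $A$ and $B$, and with $T=G[A]\cup G[B]$, ${\rm ext}_G(A,B)=\max_{\vec T\in\mathcal{D}(T)}|\{\vec S\in\mathcal{D}(G[A,B])\colon \vec S\text{ and }\vec T\text{ compatible}\}|$. -}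

module Defs where

open import Data.Bool using (Bool; true; false; _∧_; _∨_; not; if_then_else_)
open import Data.Nat using (ℕ; zero; suc; _⊔_)
open import Data.Fin using (Fin)
open import Data.Fin.Subset using (Subset; _∈_; ∣_∣; ⁅_⁆; _∪_)
open import Data.Vec using (Vec; []; _∷_; lookup)
open import Data.List using (List; []; _∷_; map; concatMap; allFin; filterᵇ; length; foldr)
open import Data.Product using (_×_)
open import Relation.Binary.PropositionalEquality using (_≡_; _≢_)
open import Relation.Nullary using (¬_)

record Graph (n : ℕ) : Set where
  field
    adj    : Fin n → Fin n → Bool
    sym    : ∀ u v → adj u v ≡ adj v u
    irrefl : ∀ u → adj u u ≡ false
open Graph public

IsClique : ∀ {n} → Graph n → Subset n → Set
IsClique G S = ∀ u v → u ∈ S → v ∈ S → u ≢ v → adj G u v ≡ true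

KFree : ∀ {n} → ℕ → Graph n → Set
KFree {n} k G = ∀ (S : Subset n) → ∣ S ∣ ≡ k → ¬ IsClique G S

Disjoint : ∀ {n} → Subset n → Subset n → Set
Disjoint A B = ∀ u → u ∈ A → u ∈ B → ⊥'
  where open import Data.Empty renaming (⊥ to ⊥')

allV : ∀ {n} → (Fin n → Bool) → Bool
allV {n} p = foldr (λ u b → p u ∧ b) true (allFin n)

Rel : ℕ → Set
Rel n = Fin n → Fin n → Bool

edgesT : ∀ {n} → Graph n → Subset n → Subset n → Rel n
edgesT G A B u v = adj G u v ∧ ((lookup A u ∧ lookup A v) ∨ (lookup B u ∧ lookup B v))

edgesAB : ∀ {n} → Graph n → Subset n → Subset n → Rel n
edgesAB G A B u v = adj G u v ∧ ((lookup A u ∧ lookup B v) ∨ (lookup B u ∧ lookup A v))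

xor : Bool → Bool → Bool
xor true  b = not b
xor false b = b

-- An orientation of an edge set E is an arc relation o (o u v = true meaning
-- the arc u → v) such that every arc is an edge of E and every edge of E
-- receives exactly one of its two directions.
isOrientation : ∀ {n} → Rel n → Rel n → Bool
isOrientation E o =
  allV λ u → allV λ v →
    (not (o u v) ∨ E u v) ∧ (not (E u v) ∨ xor (o u v) (o v u))

triangleFree : ∀ {n} → Rel n → Bool
triangleFree o = allV λ u → allV λ v → allV λ w → not (o u v ∧ o v w ∧ o w u)

isDOrientation : ∀ {n} → Rel n → Rel n → Bool
isDOrientation E o = isOrientation E o ∧ triangleFree o

_∪ᵒ_ : ∀ {n} → Rel n → Rel n → Rel n
(o₁ ∪ᵒ o₂) u v = o₁ u v ∨ o₂ u v

allVecs : ∀ {A : Set} → List A → (k : ℕ) → List (Vec A k)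
allVecs xs zero    = [] ∷ []
allVecs xs (suc k) = concatMap (λ x → map (x ∷_) (allVecs xs k)) xs

allRels : (n : ℕ) → List (Rel n)
allRels n = map (λ M u v → lookup (lookup M u) v) (allVecs (allVecs (true ∷ false ∷ []) n) n)

-- 𝒟(E) as a list (each orientation appears exactly once).
𝒟 : ∀ {n} → Rel n → List (Rel n)
𝒟 {n} E = filterᵇ (isDOrientation E) (allRels n)

compatCount : ∀ {n} → Graph n → Subset n → Subset n → Rel n → ℕ
compatCount G A B oT =
  length (filterᵇ (λ oS → triangleFree (oS ∪ᵒ oT)) (𝒟 (edgesAB G A B)))

ext : ∀ {n} → Graph n → Subset n → Subset n → ℕ
ext G A B = foldr _⊔_ 0 (map (compatCount G A B) (𝒟 (edgesT G A B)))

-- Fix a triangle-free orientation oT of T = G[A] ∪ G[B] and say it orients the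
-- edge of B as u → v.  A compatible orientation oS of G[A,B] is recorded by the
-- numbers i, j of vertices a ∈ A with a → u, resp. a → v.
--   * Nesting: for w ∈ B and two compatible oS, oS' the sets {a | a → w} are
--     nested (otherwise oT on A closes a cyclic triangle through w), so (i, j)
--     determines oS.
--   * Degrees: every w ∉ A has at most r - 1 neighbours in A (K_{r+1}-freeness).
--   * Transfer: if a → u and a ~ v then a → v (else v → a → u → v), so
--     i ≤ j + d with d the number of neighbours of u in A that miss v.
-- Shifting j by r - 1 - deg_A(v) turns these facts into an injection of the
-- compatible orientations into the staircase {(i , j) | i , j < r, i ≤ j + 1},
-- which has r² - C(r-1,2) points.
module Submission where

open import Defs hiding (sym)
open import Data.Nat using (ℕ; _≤_; _*_; _∸_; _+_)
open import Data.Nat.Combinatorics using (_C_)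
open import Data.Fin using (Fin)
open import Data.Fin.Subset using (Subset; ∣_∣; ⁅_⁆; _∪_)
open import Relation.Binary.PropositionalEquality using (_≡_; _≢_)

open import Data.Bool using (Bool; true; false; _∧_; _∨_; not; if_then_else_; T?)
open import Data.Bool.Properties using (T-≡)
open import Data.Empty using (⊥; ⊥-elim)
import Data.Fin as Fin
import Data.Fin.Subset as Sub
import Data.Fin.Subset.Properties as Subₚ
open import Data.List using (List; []; _∷_; _++_; map; length; filterᵇ; foldr; upTo; allFin)
open import Data.List.Properties using (length-map; length-++; length-upTo; length-removeAt′; foldr-preservesᵇ)
open import Data.List.Membership.Propositional using (_∈_)
open import Data.List.Membership.Propositional.Properties
  using (∈-allFin; ∈-filter⁻; ∈-map⁺; ∈-map⁻; ∈-++⁺ˡ; ∈-++⁺ʳ; ∈-upTo⁺)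
import Data.List.Relation.Unary.All as All
import Data.List.Relation.Unary.All.Properties as Allₚ
open import Data.List.Relation.Unary.AllPairs using (AllPairs; []; _∷_)
import Data.List.Relation.Unary.AllPairs as AllPairs
import Data.List.Relation.Unary.AllPairs.Properties as AllPairsₚ
open import Data.List.Relation.Unary.Any using (here; there; index; _─_)
open import Data.List.Relation.Unary.Unique.Propositional using (Unique)
import Data.List.Relation.Unary.Unique.Propositional.Properties as Uniqueₚ
open import Data.List.Relation.Binary.Disjoint.Propositional renaming (Disjoint to ListDisjoint)
open import Data.Nat using (zero; suc; z≤n; s≤s; _<_)
open import Data.Nat.Properties
open import Data.Nat.Combinatorics using (nCk+nC[k+1]≡[n+1]C[k+1]; nC1≡n)
open import Data.Nat.Solver using (module +-*-Solver)
open import Data.Product using (_×_; _,_; proj₁; proj₂; Σ)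
open import Data.Sum using (_⊎_; inj₁; inj₂)
open import Data.Vec using (Vec; lookup; _[_]≔_) renaming ([] to []ᵥ; _∷_ to _∷ᵥ_)
import Data.Vec.Properties as Vecₚ
open import Function using (_∘_)
open import Function.Bundles using (Equivalence)
open import Relation.Nullary using (¬_; yes; no)
open import Relation.Binary.PropositionalEquality using (refl; sym; trans; cong; cong₂; subst; module ≡-Reasoning)

true≢false : true ≢ false
true≢false ()

∧-trueˡ : ∀ {a b} → a ∧ b ≡ true → a ≡ true
∧-trueˡ {true} _ = refl

∧-trueʳ : ∀ {a b} → a ∧ b ≡ true → b ≡ true
∧-trueʳ {true} e = e

∧-true : ∀ {a b} → a ≡ true → b ≡ true → a ∧ b ≡ true
∧-true refl refl = refl

∨-trueˡ : ∀ {a b} → a ≡ true → a ∨ b ≡ true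
∨-trueˡ refl = refl

∨-trueʳ : ∀ {a b} → b ≡ true → a ∨ b ≡ true
∨-trueʳ {true} _ = refl
∨-trueʳ {false} e = e

∨-true-cases : ∀ {a b} → a ∨ b ≡ true → a ≡ true ⊎ b ≡ true
∨-true-cases {true} _ = inj₁ refl
∨-true-cases {false} e = inj₂ e

implication-true : ∀ {a b} → not a ∨ b ≡ true → a ≡ true → b ≡ true
implication-true {true} e refl = e

xor-true : ∀ {a b} → xor a b ≡ true → a ≡ not b
xor-true {true} {false} _ = refl
xor-true {false} {true} _ = refl

allV-true : ∀ {n} (p : Fin n → Bool) → allV p ≡ true → ∀ u → p u ≡ true
allV-true {n} p all-p u = go (allFin n) all-p (∈-allFin u)
  where
  go : ∀ L → foldr (λ w b → p w ∧ b) true L ≡ true → u ∈ L → p u ≡ true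
  go (w ∷ L) e (here refl) = ∧-trueˡ e
  go (w ∷ L) e (there u∈L) = go L (∧-trueʳ {p w} e) u∈L

∈-filterᵇ⁻ : ∀ {X : Set} (p : X → Bool) {L : List X} {x : X} → x ∈ filterᵇ p L → x ∈ L × p x ≡ true
∈-filterᵇ⁻ p x∈ with ∈-filter⁻ (T? ∘ p) x∈
... | x∈L , px = x∈L , Equivalence.to T-≡ px

module Orientation {n} (E o : Rel n) (o-orients : isOrientation E o ≡ true) where

  private
    at : ∀ p q → ((not (o p q) ∨ E p q) ∧ (not (E p q) ∨ xor (o p q) (o q p))) ≡ true
    at p q = allV-true _ (allV-true _ o-orients p) q

  arc⇒edge : ∀ p q → o p q ≡ true → E p q ≡ true
  arc⇒edge p q = implication-true (∧-trueˡ (at p q))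

  edge⇒one-direction : ∀ p q → E p q ≡ true → o p q ≡ not (o q p)
  edge⇒one-direction p q = xor-true ∘ implication-true (∧-trueʳ {not (o p q) ∨ E p q} (at p q))

  edge⇒some-direction : ∀ p q → E p q ≡ true → o p q ≡ true ⊎ o q p ≡ true
  edge⇒some-direction p q e with o q p in eqp
  ... | true = inj₂ refl
  ... | false = inj₁ (trans (edge⇒one-direction p q e) (cong not eqp))

  non-edge⇒no-arc : ∀ p q → E p q ≡ false → o p q ≡ false
  non-edge⇒no-arc p q e with o p q in eo
  ... | true = ⊥-elim (true≢false (trans (sym (arc⇒edge p q eo)) e))
  ... | false = refl

_≐_ : ∀ {n} → Rel n → Rel n → Set
o ≐ o' = ∀ p q → o p q ≡ o' p q

module _ {n} (E o o' : Rel n) (o-orients : isOrientation E o ≡ true) (o'-orients : isOrientation E o' ≡ true) where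
  private
    module O = Orientation E o o-orients
    module O' = Orientation E o' o'-orients

  orientations-agree : (∀ p q → E p q ≡ true → o p q ≡ o' p q ⊎ o q p ≡ o' q p) → o ≐ o'
  orientations-agree agree p q with E p q in eE
  ... | false = trans (O.non-edge⇒no-arc p q eE) (sym (O'.non-edge⇒no-arc p q eE))
  ... | true with agree p q eE
  ...   | inj₁ same = same
  ...   | inj₂ same-reversed = begin
    o p q        ≡⟨ O.edge⇒one-direction p q eE ⟩
    not (o q p)  ≡⟨ cong not same-reversed ⟩
    not (o' q p) ≡⟨ sym (O'.edge⇒one-direction p q eE) ⟩
    o' p q       ∎
    where open ≡-Reasoning

no-cyclic-triangle : ∀ {n} (o : Rel n) → triangleFree o ≡ true →
  ∀ p q w → o p q ≡ true → o q w ≡ true → o w p ≡ true → ⊥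
no-cyclic-triangle o tf p q w pq qw wp = absurd (allV-true _ (allV-true _ (allV-true _ tf p) q) w)
  where
  absurd : not (o p q ∧ o q w ∧ o w p) ≡ true → ⊥
  absurd e rewrite pq | qw | wp = true≢false (sym e)

∈𝒟⇒orientation : ∀ {n} {E o : Rel n} → o ∈ 𝒟 E → isOrientation E o ≡ true
∈𝒟⇒orientation {n} {E} o∈ = ∧-trueˡ (proj₂ (∈-filterᵇ⁻ (isDOrientation E) {allRels n} o∈))

count : ∀ {X : Set} → (X → Bool) → List X → ℕ
count p [] = 0
count p (x ∷ xs) = if p x then suc (count p xs) else count p xs

module _ {X : Set} where

  _⊆[_]_ : (X → Bool) → List X → (X → Bool) → Set
  p ⊆[ L ] q = ∀ x → x ∈ L → p x ≡ true → q x ≡ true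

  ⊆-tail : ∀ {p q x L} → p ⊆[ x ∷ L ] q → p ⊆[ L ] q
  ⊆-tail p⊆q y y∈L = p⊆q y (there y∈L)

  count-≤-length : ∀ (p : X → Bool) (L : List X) → count p L ≤ length L
  count-≤-length p [] = z≤n
  count-≤-length p (x ∷ L) with p x
  ... | true = s≤s (count-≤-length p L)
  ... | false = m≤n⇒m≤1+n (count-≤-length p L)

  count-mono : ∀ (p q : X → Bool) (L : List X) → p ⊆[ L ] q → count p L ≤ count q L
  count-mono p q [] _ = z≤n
  count-mono p q (x ∷ L) p⊆q with p x in px | q x in qx
  ... | true | true = s≤s (count-mono p q L (⊆-tail p⊆q))
  ... | true | false = ⊥-elim (true≢false (trans (sym (p⊆q x (here refl) px)) qx))
  ... | false | true = m≤n⇒m≤1+n (count-mono p q L (⊆-tail p⊆q))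
  ... | false | false = count-mono p q L (⊆-tail p⊆q)

  count-split : ∀ (p q : X → Bool) (L : List X) →
    count p L ≡ count (λ x → p x ∧ q x) L + count (λ x → p x ∧ not (q x)) L
  count-split p q [] = refl
  count-split p q (x ∷ L) with p x | q x
  ... | true | true = cong suc (count-split p q L)
  ... | true | false = trans (cong suc (count-split p q L)) (sym (+-suc _ _))
  ... | false | _ = count-split p q L

  count-disjoint : ∀ (p q : X → Bool) (L : List X) →
    (∀ x → x ∈ L → p x ≡ true → q x ≡ true → ⊥) → count p L + count q L ≤ length L
  count-disjoint p q [] _ = z≤n
  count-disjoint p q (x ∷ L) disj with p x in px | q x in qx | count-disjoint p q L (λ y y∈L → disj y (there y∈L))
  ... | true | true | _ = ⊥-elim (disj x (here refl) px qx)
  ... | true | false | rest = s≤s rest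
  ... | false | true | rest = subst (_≤ suc (length L)) (sym (+-suc _ _)) (s≤s rest)
  ... | false | false | rest = m≤n⇒m≤1+n rest

  count-full : ∀ (p : X → Bool) (L : List X) → count p L ≡ length L → ∀ x → x ∈ L → p x ≡ true
  count-full p (y ∷ L) full x x∈ with p y in py | x∈
  ... | true | here refl = py
  ... | true | there x∈L = count-full p L (suc-injective full) x x∈L
  ... | false | _ = ⊥-elim (<-irrefl full (s≤s (count-≤-length p L)))

  count-mono-eq : ∀ (p q : X → Bool) (L : List X) →
    p ⊆[ L ] q → count p L ≡ count q L → ∀ x → x ∈ L → p x ≡ q x
  count-mono-eq p q (y ∷ L) p⊆q same x x∈ with p y in py | q y in qy | x∈
  ... | true | true | here refl = trans py (sym qy)
  ... | true | true | there x∈L = count-mono-eq p q L (⊆-tail p⊆q) (suc-injective same) x x∈L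
  ... | false | false | here refl = trans py (sym qy)
  ... | false | false | there x∈L = count-mono-eq p q L (⊆-tail p⊆q) same x x∈L
  ... | true | false | _ = ⊥-elim (true≢false (trans (sym (p⊆q y (here refl) py)) qy))
  ... | false | true | _ = ⊥-elim (<-irrefl same (s≤s (count-mono p q L (⊆-tail p⊆q))))

  ⊆-or-witness : ∀ (p q : X → Bool) (L : List X) →
    p ⊆[ L ] q ⊎ Σ X (λ a → a ∈ L × p a ≡ true × q a ≡ false)
  ⊆-or-witness p q [] = inj₁ (λ _ ())
  ⊆-or-witness p q (y ∷ L) with p y in py | q y in qy | ⊆-or-witness p q L
  ... | true | false | _ = inj₂ (y , here refl , py , qy)
  ... | _ | _ | inj₂ (a , a∈L , pa , qa) = inj₂ (a , there a∈L , pa , qa)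
  ... | true | true | inj₁ p⊆q = inj₁ λ { x (here refl) _ → qy ; x (there x∈L) → p⊆q x x∈L }
  ... | false | _ | inj₁ p⊆q = inj₁ λ { x (here refl) px → ⊥-elim (true≢false (trans (sym px) py)) ; x (there x∈L) → p⊆q x x∈L }

  comparable-count-eq : ∀ (p q : X → Bool) (L : List X) →
    (∀ a a' → a ∈ L → a' ∈ L → p a ≡ true → q a ≡ false → q a' ≡ true → p a' ≡ false → ⊥) →
    count p L ≡ count q L → ∀ x → x ∈ L → p x ≡ q x
  comparable-count-eq p q L comparable same with ⊆-or-witness p q L
  ... | inj₁ p⊆q = count-mono-eq p q L p⊆q same
  ... | inj₂ (a , a∈L , pa , qa) = λ x x∈L → sym (count-mono-eq q p L q⊆p (sym same) x x∈L)
    where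
    q⊆p : q ⊆[ L ] p
    q⊆p x x∈L qx with p x in px
    ... | true = refl
    ... | false = ⊥-elim (comparable a x a∈L x∈L pa qa qx px)

∈-─ : ∀ {X : Set} {x y : X} {K : List X} (x∈K : x ∈ K) → y ∈ K → y ≢ x → y ∈ (K ─ x∈K)
∈-─ (here refl) (here refl) y≢x = ⊥-elim (y≢x refl)
∈-─ (here refl) (there y∈K) _ = y∈K
∈-─ (there _) (here refl) _ = here refl
∈-─ (there x∈K) (there y∈K) y≢x = there (∈-─ x∈K y∈K y≢x)

injection-length-≤ : ∀ {X C : Set} (R : X → X → Set) (f : X → C) {K : List C} (xs : List X) →
  AllPairs R xs → (∀ {x} → x ∈ xs → f x ∈ K) →
  (∀ {x y} → x ∈ xs → y ∈ xs → R x y → f x ≢ f y) → length xs ≤ length K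
injection-length-≤ R f [] _ _ _ = z≤n
injection-length-≤ R f {K} (x ∷ xs) (Rx ∷ distinct) into injective =
  subst (suc (length xs) ≤_) (sym (length-removeAt′ K (index fx∈K)))
    (s≤s (injection-length-≤ R f xs distinct into-rest (λ x∈ y∈ → injective (there x∈) (there y∈))))
  where
  fx∈K : f x ∈ K
  fx∈K = into (here refl)
  into-rest : ∀ {y} → y ∈ xs → f y ∈ (K ─ fx∈K)
  into-rest y∈ = ∈-─ fx∈K (into (there y∈))
    (λ fy≡fx → injective (here refl) (there y∈) (All.lookup Rx y∈) (sym fy≡fx))

allVecs-unique : ∀ {X : Set} {xs : List X} → Unique xs → ∀ k → Unique (allVecs xs k)
allVecs-unique _ zero = All.[] ∷ []
allVecs-unique {xs = xs} xs! (suc k) =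
  Uniqueₚ.concat⁺ (Allₚ.map⁺ (All.tabulate λ _ → Uniqueₚ.map⁺ Vecₚ.∷-injectiveʳ (allVecs-unique xs! k)))
                  (AllPairsₚ.map⁺ (AllPairs.map disjoint xs!))
  where
  disjoint : ∀ {x y} → x ≢ y → ListDisjoint (map (x ∷ᵥ_) (allVecs xs k)) (map (y ∷ᵥ_) (allVecs xs k))
  disjoint x≢y (v∈x , v∈y) with ∈-map⁻ _ v∈x | ∈-map⁻ _ v∈y
  ... | _ , _ , refl | _ , _ , e = x≢y (Vecₚ.∷-injectiveˡ e)

allRels-distinct : ∀ n → AllPairs (λ o o' → ¬ o ≐ o') (allRels n)
allRels-distinct n = AllPairsₚ.map⁺ (AllPairs.map (λ M≢M' o≐o' → M≢M' (lookup-ext (lookup-ext ∘ o≐o')))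
  (allVecs-unique (allVecs-unique bools! n) n))
  where
  bools! : Unique (true ∷ false ∷ [])
  bools! = ((λ ()) All.∷ All.[]) ∷ All.[] ∷ []
  lookup-ext : ∀ {Y : Set} {k} {xs ys : Vec Y k} → (∀ i → lookup xs i ≡ lookup ys i) → xs ≡ ys
  lookup-ext {xs = xs} {ys} same =
    trans (sym (Vecₚ.tabulate∘lookup xs)) (trans (Vecₚ.tabulate-cong same) (Vecₚ.tabulate∘lookup ys))

∈⇒true : ∀ {n} {S : Subset n} {u} → u Sub.∈ S → lookup S u ≡ true
∈⇒true = Vecₚ.[]=⇒lookup

true⇒∈ : ∀ {n} (S : Subset n) u → lookup S u ≡ true → u Sub.∈ S
true⇒∈ S u = Vecₚ.lookup⇒[]= u S

members : ∀ {n} → Subset n → List (Fin n)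
members []ᵥ = []
members (true ∷ᵥ S) = Fin.zero ∷ map Fin.suc (members S)
members (false ∷ᵥ S) = map Fin.suc (members S)

length-members : ∀ {n} (S : Subset n) → length (members S) ≡ ∣ S ∣
length-members []ᵥ = refl
length-members (true ∷ᵥ S) = cong suc (trans (length-map Fin.suc (members S)) (length-members S))
length-members (false ∷ᵥ S) = trans (length-map Fin.suc (members S)) (length-members S)

members-sound : ∀ {n} (S : Subset n) {a} → a ∈ members S → lookup S a ≡ true
members-sound (true ∷ᵥ S) (here refl) = refl
members-sound (true ∷ᵥ S) (there a∈) with ∈-map⁻ Fin.suc a∈
... | _ , b∈ , refl = members-sound S b∈
members-sound (false ∷ᵥ S) a∈ with ∈-map⁻ Fin.suc a∈
... | _ , b∈ , refl = members-sound S b∈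

members-complete : ∀ {n} (S : Subset n) a → lookup S a ≡ true → a ∈ members S
members-complete (true ∷ᵥ S) Fin.zero _ = here refl
members-complete (true ∷ᵥ S) (Fin.suc a) e = there (∈-map⁺ Fin.suc (members-complete S a e))
members-complete (false ∷ᵥ S) (Fin.suc a) e = ∈-map⁺ Fin.suc (members-complete S a e)

∣insert∣ : ∀ {n} (S : Subset n) w → lookup S w ≡ false → ∣ S [ w ]≔ true ∣ ≡ suc ∣ S ∣
∣insert∣ (false ∷ᵥ S) Fin.zero _ = refl
∣insert∣ (true ∷ᵥ S) (Fin.suc w) e = cong suc (∣insert∣ S w e)
∣insert∣ (false ∷ᵥ S) (Fin.suc w) e = ∣insert∣ S w e

lookup-insert : ∀ {n} (S : Subset n) w p → lookup (S [ w ]≔ true) p ≡ true → p ≡ w ⊎ lookup S p ≡ true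
lookup-insert S w p e with p Fin.≟ w
... | yes p≡w = inj₁ p≡w
... | no p≢w = inj₂ (trans (sym (Vecₚ.lookup∘update′ p≢w S true)) e)

-- The staircase {(i , j) | i , j < r, i ≤ j + 1}, built column by column:
-- passing from r = k to k + 1 adds the column (0 , k) … (k , k) and the
-- point (k , k - 1) just below the diagonal.
below-diagonal : ℕ → List (ℕ × ℕ)
below-diagonal zero = []
below-diagonal (suc j) = (suc j , j) ∷ []

staircase : ℕ → List (ℕ × ℕ)
staircase zero = []
staircase (suc k) = staircase k ++ (map (λ i → (i , k)) (upTo (suc k)) ++ below-diagonal k)

∈-staircase : ∀ r {i j} → i < r → j < r → i ≤ suc j → (i , j) ∈ staircase r
∈-staircase (suc k) {i} {j} (s≤s i≤k) (s≤s j≤k) i≤1+j with m≤n⇒m<n∨m≡n i≤k | m≤n⇒m<n∨m≡n j≤k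
... | inj₁ i<k | inj₁ j<k = ∈-++⁺ˡ (∈-staircase k i<k j<k i≤1+j)
... | _ | inj₂ refl = ∈-++⁺ʳ (staircase k) (∈-++⁺ˡ (∈-map⁺ (λ i → (i , k)) (∈-upTo⁺ (s≤s i≤k))))
... | inj₂ refl | inj₁ j<i with ≤-antisym i≤1+j j<i
...   | refl = ∈-++⁺ʳ (staircase k) (∈-++⁺ʳ (map (λ i → (i , k)) (upTo (suc k))) (here refl))

length-staircase : ∀ k → length (staircase (suc k)) + k C 2 ≡ suc k * suc k
length-staircase zero = refl
length-staircase (suc k) = begin
  length (staircase (suc k) ++ new) + suc k C 2         ≡⟨ cong₂ _+_ (length-++ (staircase (suc k))) (sym pascal) ⟩
  length (staircase (suc k)) + length new + (k + k C 2) ≡⟨ cong (λ z → length (staircase (suc k)) + z + (k + k C 2)) length-new ⟩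
  length (staircase (suc k)) + (2 + k + 1) + (k + k C 2) ≡⟨ regroup (length (staircase (suc k))) (k C 2) k ⟩
  length (staircase (suc k)) + k C 2 + (3 + 2 * k)      ≡⟨ cong (_+ (3 + 2 * k)) (length-staircase k) ⟩
  suc k * suc k + (3 + 2 * k)                           ≡⟨ square-step k ⟩
  suc (suc k) * suc (suc k)                             ∎
  where
  open ≡-Reasoning
  open +-*-Solver
  new : List (ℕ × ℕ)
  new = map (λ i → (i , suc k)) (upTo (suc (suc k))) ++ below-diagonal (suc k)
  length-new : length new ≡ 2 + k + 1
  length-new = trans (length-++ (map (λ i → (i , suc k)) (upTo (suc (suc k)))))
                     (cong (_+ 1) (trans (length-map _ (upTo (suc (suc k)))) (length-upTo (suc (suc k)))))
  pascal : k + k C 2 ≡ suc k C 2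
  pascal = trans (cong (_+ k C 2) (sym (nC1≡n k))) (nCk+nC[k+1]≡[n+1]C[k+1] k 1)
  regroup : ∀ L c k → L + (2 + k + 1) + (k + c) ≡ L + c + (3 + 2 * k)
  regroup = solve 3 (λ L c k → L :+ (con 2 :+ k :+ con 1) :+ (k :+ c) := L :+ c :+ (con 3 :+ con 2 :* k)) refl
  square-step : ∀ k → suc k * suc k + (3 + 2 * k) ≡ suc (suc k) * suc (suc k)
  square-step = solve 1 (λ k → (con 1 :+ k) :* (con 1 :+ k) :+ (con 3 :+ con 2 :* k) := (con 2 :+ k) :* (con 2 :+ k)) refl

staircase-size : ∀ k → length (staircase (suc k)) ≡ suc k * suc k ∸ k C 2
staircase-size k = trans (sym (m+n∸n≡m _ (k C 2))) (cong (_∸ k C 2) (length-staircase k))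

module OrientedPair
  {n} (G : Graph n) (A B : Subset n) (u v : Fin n) (k : ℕ)
  (K-free : KFree (suc k + 1) G) (clique-A : IsClique G A) (|A|≡r : ∣ A ∣ ≡ suc k)
  (u∉A : lookup A u ≡ false) (v∉A : lookup A v ≡ false)
  (v∈B : lookup B v ≡ true) (B⊆uv : ∀ w → lookup B w ≡ true → w ≡ u ⊎ w ≡ v)
  (oT : Rel n) (u→v : oT u v ≡ true)
  (tournament-A : ∀ a a' → lookup A a ≡ true → lookup A a' ≡ true → a ≢ a' → oT a a' ≡ true ⊎ oT a' a ≡ true)
  where

  As : List (Fin n)
  As = members A

  length-As : length As ≡ suc k
  length-As = trans (length-members A) |A|≡r

  E : Rel n
  E = edgesAB G A B

  compatible : List (Rel n)
  compatible = filterᵇ (λ oS → triangleFree (oS ∪ᵒ oT)) (𝒟 E)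

  compatible⇒ : ∀ {oS} → oS ∈ compatible → isOrientation E oS ≡ true × triangleFree (oS ∪ᵒ oT) ≡ true
  compatible⇒ {oS} oS∈ with ∈-filterᵇ⁻ (λ oS → triangleFree (oS ∪ᵒ oT)) {𝒟 E} oS∈
  ... | oS∈𝒟 , tf = ∈𝒟⇒orientation oS∈𝒟 , tf

  adj-sym : ∀ p q → adj G p q ≡ true → adj G q p ≡ true
  adj-sym p q e = trans (Graph.sym G q p) e

  cross-edge : ∀ a w → lookup A a ≡ true → lookup B w ≡ true → adj G w a ≡ true → E w a ≡ true
  cross-edge a w a∈A w∈B e rewrite e | a∈A | w∈B = ∨-trueʳ {lookup A w ∧ lookup B a} refl

  edge-sides : ∀ p q → E p q ≡ true → (lookup A p ≡ true × lookup B q ≡ true) ⊎ (lookup B p ≡ true × lookup A q ≡ true)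
  edge-sides p q e with ∨-true-cases (∧-trueʳ {adj G p q} e)
  ... | inj₁ AB = inj₁ (∧-trueˡ AB , ∧-trueʳ {lookup A p} AB)
  ... | inj₂ BA = inj₂ (∧-trueˡ BA , ∧-trueʳ {lookup B p} BA)

  degree : Fin n → ℕ
  degree w = count (λ a → adj G a w) As

  -- A vertex outside A misses some vertex of A, else A ∪ {w} is a K_{r+1}.
  degree-bound : ∀ w → lookup A w ≡ false → degree w ≤ k
  degree-bound w w∉A = ≤-pred (≤∧≢⇒< (subst (degree w ≤_) length-As (count-≤-length _ As)) not-full)
    where
    not-full : degree w ≢ suc k
    not-full full = K-free (A [ w ]≔ true) (trans (∣insert∣ A w w∉A) (trans (cong suc |A|≡r) (+-comm 1 (suc k)))) clique
      where
      w~A : ∀ a → lookup A a ≡ true → adj G a w ≡ true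
      w~A a a∈A = count-full _ As (trans full (sym length-As)) a (members-complete A a a∈A)
      clique : IsClique G (A [ w ]≔ true)
      clique p q p∈ q∈ p≢q with lookup-insert A w p (∈⇒true p∈) | lookup-insert A w q (∈⇒true q∈)
      ... | inj₁ refl | inj₁ refl = ⊥-elim (p≢q refl)
      ... | inj₁ refl | inj₂ q∈A = adj-sym q p (w~A q q∈A)
      ... | inj₂ p∈A | inj₁ refl = w~A p p∈A
      ... | inj₂ p∈A | inj₂ q∈A = clique-A p q (true⇒∈ A p p∈A) (true⇒∈ A q q∈A) p≢q

  in-degree : Rel n → Fin n → ℕ
  in-degree oS w = count (λ a → oS a w) As

  module _ {oS} (oS∈ : oS ∈ compatible) where
    private
      module O = Orientation E oS (proj₁ (compatible⇒ oS∈))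

    arc⇒adj : ∀ a w → oS a w ≡ true → adj G a w ≡ true
    arc⇒adj a w = ∧-trueˡ ∘ O.arc⇒edge a w

    reversed : ∀ a w → a ∈ As → lookup B w ≡ true → adj G a w ≡ true → oS a w ≡ false → oS w a ≡ true
    reversed a w a∈ w∈B a~w no-arc =
      trans (O.edge⇒one-direction w a (cross-edge a w (members-sound A a∈) w∈B (adj-sym a w a~w))) (cong not no-arc)

    -- Transfer: a → u and a ~ v force a → v, since v → a → u → v is cyclic.
    transfer : ∀ a → a ∈ As → (oS a u ∧ adj G a v) ≡ true → oS a v ≡ true
    transfer a a∈ e with oS a v in a↛v
    ... | true = refl
    ... | false = ⊥-elim (no-cyclic-triangle (oS ∪ᵒ oT) (proj₂ (compatible⇒ oS∈)) u v a
      (∨-trueʳ {oS u v} u→v) (∨-trueˡ (reversed a v a∈ v∈B (∧-trueʳ {oS a u} e) a↛v)) (∨-trueˡ (∧-trueˡ {oS a u} e)))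

    in-degree-u-bound : in-degree oS u ≤ in-degree oS v + count (λ a → adj G a u ∧ not (adj G a v)) As
    in-degree-u-bound = begin
      in-degree oS u                                           ≡⟨ count-split _ (λ a → adj G a v) As ⟩
      count (λ a → oS a u ∧ adj G a v) As
        + count (λ a → oS a u ∧ not (adj G a v)) As            ≤⟨ +-mono-≤ (count-mono _ _ As transfer)
                                                                            (count-mono _ _ As only-u) ⟩
      in-degree oS v + count (λ a → adj G a u ∧ not (adj G a v)) As ∎
      where
      open ≤-Reasoning
      only-u : (λ a → oS a u ∧ not (adj G a v)) ⊆[ As ] (λ a → adj G a u ∧ not (adj G a v))
      only-u a _ e = ∧-true (arc⇒adj a u (∧-trueˡ e)) (∧-trueʳ {oS a u} e)

  -- Nesting: for w ∈ B, the sets of vertices of A sending an arc to w under two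
  -- compatible orientations are comparable, so equal sizes make them equal.
  in-neighbours-determined : ∀ {oS oS'} → oS ∈ compatible → oS' ∈ compatible → ∀ w → lookup B w ≡ true →
    in-degree oS w ≡ in-degree oS' w → ∀ a → a ∈ As → oS a w ≡ oS' a w
  in-neighbours-determined {oS} {oS'} oS∈ oS'∈ w w∈B = comparable-count-eq _ _ As comparable
    where
    comparable : ∀ a a' → a ∈ As → a' ∈ As → oS a w ≡ true → oS' a w ≡ false → oS' a' w ≡ true → oS a' w ≡ false → ⊥
    comparable a a' a∈ a'∈ a→w a↛'w a'→'w a'↛w with tournament-A a a' (members-sound A a∈) (members-sound A a'∈) a≢a'
      where
      a≢a' : a ≢ a'
      a≢a' refl = true≢false (trans (sym a→w) a'↛w)
    ... | inj₁ a→a' = no-cyclic-triangle (oS' ∪ᵒ oT) (proj₂ (compatible⇒ oS'∈)) w a a'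
      (∨-trueˡ (reversed oS'∈ a w a∈ w∈B (arc⇒adj oS∈ a w a→w) a↛'w)) (∨-trueʳ {oS' a a'} a→a') (∨-trueˡ a'→'w)
    ... | inj₂ a'→a = no-cyclic-triangle (oS ∪ᵒ oT) (proj₂ (compatible⇒ oS∈)) w a' a
      (∨-trueˡ (reversed oS∈ a' w a'∈ w∈B (arc⇒adj oS'∈ a' w a'→'w) a'↛w)) (∨-trueʳ {oS a' a} a'→a) (∨-trueˡ a→w)

  -- The code of oS: i and j shifted by the slack k - degree v of v.
  code : Rel n → ℕ × ℕ
  code oS = in-degree oS u , in-degree oS v + (k ∸ degree v)

  code-injective : ∀ {oS oS'} → oS ∈ compatible → oS' ∈ compatible → code oS ≡ code oS' → oS ≐ oS'
  code-injective {oS} {oS'} oS∈ oS'∈ same =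
    orientations-agree E oS oS' (proj₁ (compatible⇒ oS∈)) (proj₁ (compatible⇒ oS'∈)) agree-on-edges
    where
    same-in-degree : ∀ w → lookup B w ≡ true → in-degree oS w ≡ in-degree oS' w
    same-in-degree w w∈B with B⊆uv w w∈B
    ... | inj₁ refl = cong proj₁ same
    ... | inj₂ refl = +-cancelʳ-≡ (k ∸ degree v) _ _ (cong proj₂ same)
    agree-A→B : ∀ a w → lookup A a ≡ true → lookup B w ≡ true → oS a w ≡ oS' a w
    agree-A→B a w a∈A w∈B = in-neighbours-determined oS∈ oS'∈ w w∈B (same-in-degree w w∈B) a (members-complete A a a∈A)
    agree-on-edges : ∀ p q → E p q ≡ true → oS p q ≡ oS' p q ⊎ oS q p ≡ oS' q p
    agree-on-edges p q e with edge-sides p q e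
    ... | inj₁ (p∈A , q∈B) = inj₁ (agree-A→B p q p∈A q∈B)
    ... | inj₂ (p∈B , q∈A) = inj₂ (agree-A→B q p q∈A p∈B)

  code-in-staircase : ∀ {oS} → oS ∈ compatible → code oS ∈ staircase (suc k)
  code-in-staircase {oS} oS∈ = ∈-staircase (suc k) (s≤s i≤k) (s≤s j'≤k) i≤1+j'
    where
    i = in-degree oS u
    j = in-degree oS v
    t = degree v
    d = count (λ a → adj G a u ∧ not (adj G a v)) As
    t≤k : t ≤ k
    t≤k = degree-bound v v∉A
    i≤k : i ≤ k
    i≤k = ≤-trans (count-mono _ _ As (λ a _ → arc⇒adj oS∈ a u)) (degree-bound u u∉A)
    j'≤k : j + (k ∸ t) ≤ k
    j'≤k = ≤-trans (+-monoˡ-≤ (k ∸ t) (count-mono _ _ As (λ a _ → arc⇒adj oS∈ a v))) (≤-reflexive (m+[n∸m]≡n t≤k))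
    d+t≤r : d + t ≤ suc k
    d+t≤r = subst (d + t ≤_) length-As (count-disjoint _ _ As misses-v)
      where
      misses-v : ∀ a → a ∈ As → (adj G a u ∧ not (adj G a v)) ≡ true → adj G a v ≡ true → ⊥
      misses-v a _ da ta rewrite ta = true≢false (sym (∧-trueʳ {adj G a u} da))
    d≤1+slack : d ≤ suc (k ∸ t)
    d≤1+slack = ≤-trans (m+n≤o⇒m≤o∸n d d+t≤r) (≤-reflexive (+-∸-assoc 1 t≤k))
    i≤1+j' : i ≤ suc (j + (k ∸ t))
    i≤1+j' = ≤-trans (in-degree-u-bound oS∈)
               (≤-trans (+-monoʳ-≤ j d≤1+slack) (≤-reflexive (+-suc j (k ∸ t))))

  compatible-bound : compatCount G A B oT ≤ length (staircase (suc k))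
  compatible-bound = injection-length-≤ (λ o o' → ¬ o ≐ o') code compatible
    (AllPairsₚ.filter⁺ _ (AllPairsₚ.filter⁺ _ (allRels-distinct n)))
    code-in-staircase (λ oS∈ oS'∈ differ same → differ (code-injective oS∈ oS'∈ same))

pair-members : ∀ {n} {B : Subset n} {x y : Fin n} → B ≡ ⁅ x ⁆ ∪ ⁅ y ⁆ →
  lookup B x ≡ true × lookup B y ≡ true × (∀ w → lookup B w ≡ true → w ≡ x ⊎ w ≡ y)
pair-members {x = x} {y} refl =
  ∈⇒true (Subₚ.x∈p∪q⁺ {q = ⁅ y ⁆} (inj₁ (Subₚ.x∈⁅x⁆ x))) , ∈⇒true (Subₚ.x∈p∪q⁺ {p = ⁅ x ⁆} (inj₂ (Subₚ.x∈⁅x⁆ y))) , only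
  where
  only : ∀ w → lookup (⁅ x ⁆ ∪ ⁅ y ⁆) w ≡ true → w ≡ x ⊎ w ≡ y
  only w e with Subₚ.x∈p∪q⁻ ⁅ x ⁆ ⁅ y ⁆ (true⇒∈ _ w e)
  ... | inj₁ w∈x = inj₁ (Subₚ.x∈⁅y⁆⇒x≡y x w∈x)
  ... | inj₂ w∈y = inj₂ (Subₚ.x∈⁅y⁆⇒x≡y y w∈y)

edgesT-in-A : ∀ {n} (G : Graph n) (A B : Subset n) {p q} →
  lookup A p ≡ true → lookup A q ≡ true → adj G p q ≡ true → edgesT G A B p q ≡ true
edgesT-in-A G A B p∈A q∈A p~q rewrite p~q | p∈A | q∈A = refl

edgesT-in-B : ∀ {n} (G : Graph n) (A B : Subset n) {p q} →
  lookup B p ≡ true → lookup B q ≡ true → adj G p q ≡ true → edgesT G A B p q ≡ true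
edgesT-in-B G A B {p} {q} p∈B q∈B p~q rewrite p~q | p∈B | q∈B = ∨-trueʳ {lookup A p ∧ lookup A q} refl

disjoint⇒∉ : ∀ {n} (A B : Subset n) → Disjoint A B → ∀ w → lookup B w ≡ true → lookup A w ≡ false
disjoint⇒∉ A B A∩B=∅ w w∈B with lookup A w in w∈A
... | true = ⊥-elim (A∩B=∅ w (true⇒∈ A w w∈A) (true⇒∈ B w w∈B))
... | false = refl

per-orientation-bound : ∀ {n} (k : ℕ) (G : Graph n) → KFree (suc k + 1) G →
  (A B : Subset n) (x y : Fin n) → x ≢ y → B ≡ ⁅ x ⁆ ∪ ⁅ y ⁆ →
  Disjoint A B → IsClique G A → IsClique G B → ∣ A ∣ ≡ suc k →
  ∀ oT → oT ∈ 𝒟 (edgesT G A B) → compatCount G A B oT ≤ length (staircase (suc k))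
per-orientation-bound k G K-free A B x y x≢y B≡xy A∩B=∅ clique-A clique-B |A|≡r oT oT∈ =
  orient-xy (O.edge⇒some-direction x y (edgesT-in-B G A B x∈B y∈B (clique-B x y (true⇒∈ B x x∈B) (true⇒∈ B y y∈B) x≢y)))
  where
  module O = Orientation (edgesT G A B) oT (∈𝒟⇒orientation oT∈)
  x∈B : lookup B x ≡ true
  x∈B = proj₁ (pair-members B≡xy)
  y∈B : lookup B y ≡ true
  y∈B = proj₁ (proj₂ (pair-members B≡xy))
  B⊆xy : ∀ w → lookup B w ≡ true → w ≡ x ⊎ w ≡ y
  B⊆xy = proj₂ (proj₂ (pair-members B≡xy))
  ∉A : ∀ w → lookup B w ≡ true → lookup A w ≡ false
  ∉A = disjoint⇒∉ A B A∩B=∅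
  B⊆yx : ∀ w → lookup B w ≡ true → w ≡ y ⊎ w ≡ x
  B⊆yx w w∈B with B⊆xy w w∈B
  ... | inj₁ w≡x = inj₂ w≡x
  ... | inj₂ w≡y = inj₁ w≡y
  tournament-A : ∀ a a' → lookup A a ≡ true → lookup A a' ≡ true → a ≢ a' → oT a a' ≡ true ⊎ oT a' a ≡ true
  tournament-A a a' a∈A a'∈A a≢a' = O.edge⇒some-direction a a'
    (edgesT-in-A G A B a∈A a'∈A (clique-A a a' (true⇒∈ A a a∈A) (true⇒∈ A a' a'∈A) a≢a'))
  orient-xy : oT x y ≡ true ⊎ oT y x ≡ true → compatCount G A B oT ≤ length (staircase (suc k))
  orient-xy (inj₁ x→y) = OrientedPair.compatible-bound G A B x y k K-free clique-A |A|≡r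
    (∉A x x∈B) (∉A y y∈B) y∈B B⊆xy oT x→y tournament-A
  orient-xy (inj₂ y→x) = OrientedPair.compatible-bound G A B y x k K-free clique-A |A|≡r
    (∉A y y∈B) (∉A x x∈B) x∈B B⊆yx oT y→x tournament-A

corollary2p5 : ∀ (r n : ℕ) → 2 ≤ r → (G : Graph n) → KFree (r + 1) G →
    (A B : Subset n) (x y : Fin n) → x ≢ y → B ≡ ⁅ x ⁆ ∪ ⁅ y ⁆ →
    Disjoint A B → IsClique G A → IsClique G B → ∣ A ∣ ≡ r →
    ext G A B ≤ r * r ∸ ((r ∸ 1) C 2)
-- ext is a maximum over the orientations of T, each bounded by the staircase size.
corollary2p5 (suc k) n (s≤s _) G K-free A B x y x≢y B≡xy A∩B=∅ clique-A clique-B |A|≡r =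
  foldr-preservesᵇ {P = _≤ suc k * suc k ∸ k C 2} ⊔-lub z≤n (Allₚ.map⁺ (All.tabulate per-orientation))
  where
  per-orientation : ∀ {oT} → oT ∈ 𝒟 (edgesT G A B) → compatCount G A B oT ≤ suc k * suc k ∸ k C 2
  per-orientation {oT} oT∈ = subst (compatCount G A B oT ≤_) (staircase-size k)
    (per-orientation-bound k G K-free A B x y x≢y B≡xy A∩B=∅ clique-A clique-B |A|≡r oT oT∈)
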